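{- If $G=(V,E)$ is a uniformly dense graph containing a cycle, then its girth satisfies $\operatorname{gir}(G)\ge \rho(G)/(\rho(G)-1)$.
   Context: Graphs are finite and simple. For $A\subseteq E$, $\operatorname{rank}(A)=|V|-c(A)$ where $c(A)$ is the number of connected components of $(V,A)$; $\rho(A)=|A|/\operatorname{rank}(A)$ for nonempty $A$, $\rho(G)=\rho(E)$. $G$ is uniformly dense if $\rho(A)\le\rho(E)$ for all nonempty $A\subseteq E$. The girth is the length of a shortest cycle. -}

module Defs where

open import Data.Nat using (ℕ; zero; suc; _+_; _*_; _∸_; _≤_)
open import Data.Fin using (Fin; zero; suc; inject₁; fromℕ)
open import Data.Fin.Subset using (Subset; _∈_; ⊤; ∣_∣; Nonempty)
open import Data.Product using (Σ; ∃; _×_; _,_; proj₁; proj₂)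
open import Data.Sum using (_⊎_)
open import Function.Bundles using (_⇔_)
open import Function.Definitions using (Injective; Surjective)
open import Relation.Binary.PropositionalEquality using (_≡_; _≢_)
open import Relation.Binary.Construct.Closure.ReflexiveTransitive using (Star)

SameEnds : ∀ {n} → Fin n × Fin n → Fin n × Fin n → Set
SameEnds (u , v) (u' , v') = (u ≡ u' × v ≡ v') ⊎ (u ≡ v' × v ≡ u')

record Graph : Set where
  field
    n        : ℕ
    m        : ℕ
    ends     : Fin m → Fin n × Fin n
    loopless : ∀ e → proj₁ (ends e) ≢ proj₂ (ends e)
    simple   : ∀ e f → SameEnds (ends e) (ends f) → e ≡ f

module _ (G : Graph) where
  open Graph G

  Step : Subset m → Fin n → Fin n → Set
  Step A u v = Σ (Fin m) λ e → e ∈ A × SameEnds (ends e) (u , v)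

  Connected : Subset m → Fin n → Fin n → Set
  Connected A = Star (Step A)

  NumComponents : Subset m → ℕ → Set
  NumComponents A k =
    Σ (Fin n → Fin k) λ f → Surjective _≡_ _≡_ f ×
      (∀ u v → (f u ≡ f v) ⇔ Connected A u v)

  -- rank(A) = |V| - c(A)
  rank : (k : ℕ) → ℕ
  rank k = n ∸ k

  Adjacent : Fin n → Fin n → Set
  Adjacent = Step ⊤

  IsCycle : (len : ℕ) → Set
  IsCycle zero = Data.Empty.⊥ where import Data.Empty
  IsCycle (suc l) =
    2 ≤ l × Σ (Fin (suc l) → Fin n) λ w → Injective _≡_ _≡_ w ×
      ((∀ (i : Fin l) → Adjacent (w (inject₁ i)) (w (suc i))) ×
       Adjacent (w (fromℕ l)) (w zero))

  HasCycle : Set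
  HasCycle = ∃ λ len → IsCycle len

  IsGirth : ℕ → Set
  IsGirth g = IsCycle g × (∀ len → IsCycle len → g ≤ len)

  -- ρ(A) ≤ ρ(E) for every nonempty A, with ρ(A) = |A| / rank(A);
  -- written by cross-multiplication (ranks of nonempty sets are positive).
  UniformlyDense : Set
  UniformlyDense =
    ∀ (A : Subset m) (kA kE : ℕ) → NumComponents A kA → NumComponents ⊤ kE →
      Nonempty A → ∣ A ∣ * rank kE ≤ m * rank kA

-- Let C be a cycle of length g and A its edge set. Then |A| = g, and since
-- the vertices of C form one component of (V, A) while every other vertex is
-- isolated, rank(A) = g − 1. Uniform density applied to A gives
-- g · rank(E) ≤ |E| · (g − 1), i.e. |E| ≤ g · (|E| − rank(E)), which is the
-- cross-multiplied form of g ≥ ρ/(ρ − 1).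
module Submission where

open import Defs
open import Data.Nat using (ℕ; _*_; _∸_; _≤_)
open import Data.Fin.Subset using (⊤)

open import Level using (Level; 0ℓ)
open import Data.Nat using (suc; _+_; s≤s)
open import Data.Nat.Properties
  using (m≤n+o⇒m∸n≤o; m≢1+n+m; m+n∸n≡m; *-comm; *-distribˡ-∸;
         ∸-monoʳ-≤; *-monoˡ-≤; *-monoʳ-≤; module ≤-Reasoning)
open import Data.Fin using (Fin; zero; suc; inject₁; fromℕ; toℕ; join; splitAt)
open import Data.Fin.Properties
  using (_≟_; any?; injective⇒≤; suc-injective; toℕ-inject₁; splitAt-join)
open import Data.Fin.Induction using (<-weakInduction)
open import Data.Fin.Subset using (Subset; _∈_; ∣_∣; inside; outside)
open import Data.Vec using (_∷_; tabulate)
open import Data.Vec.Base using (here; there)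
open import Data.Vec.Properties using (lookup⇒[]=; []=⇒lookup; lookup∘tabulate)
open import Data.Product using (∃; ∃₂; _×_; _,_; proj₁; proj₂; uncurry)
open import Data.Sum using (_⊎_; inj₁; inj₂; [_,_])
open import Data.Sum.Properties using (inj₁-injective)
open import Data.Empty using (⊥-elim)
open import Function using (_∘_)
open import Function.Bundles using (_⇔_; mk⇔; Equivalence)
open import Function.Definitions using (Injective; Surjective)
open import Relation.Nullary using (Dec; yes; no; ¬_; does)
open import Relation.Nullary.Decidable using (_×-dec_; _⊎-dec_; dec-true)
import Relation.Nullary.Decidable as Dec
open import Relation.Unary using (Pred; Decidable)
open import Relation.Binary using (Rel; IsEquivalence; IsDecEquivalence)
import Relation.Binary.Construct.On as On
open import Relation.Binary.PropositionalEquality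
  using (_≡_; _≢_; refl; sym; trans; cong; subst; module ≡-Reasoning)
open import Relation.Binary.Construct.Closure.ReflexiveTransitive
  using (ε; _◅_; _◅◅_; reverse)

open Equivalence using (to; from)

private
  variable
    ℓ : Level
    k l n : ℕ

cross-multiplied-girth-bound : ∀ m l r → suc l * r ≤ m * l → m ≤ suc l * (m ∸ r)
cross-multiplied-girth-bound m l r lr≤ml = begin
  m                          ≡⟨ sym (m+n∸n≡m m (m * l)) ⟩
  m + m * l ∸ m * l          ≡⟨ cong (λ t → m + t ∸ m * l) (*-comm m l) ⟩
  suc l * m ∸ m * l          ≤⟨ ∸-monoʳ-≤ (suc l * m) lr≤ml ⟩
  suc l * m ∸ suc l * r      ≡⟨ sym (*-distribˡ-∸ (suc l) m r) ⟩
  suc l * (m ∸ r)            ∎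
  where open ≤-Reasoning

Image : {A : Set} → (Fin k → A) → Pred A 0ℓ
Image h x = ∃ λ i → h i ≡ x

image? : (h : Fin k → Fin n) → Decidable (Image h)
image? h x = any? (λ i → h i ≟ x)

image : (Fin k → Fin n) → Subset n
image h = tabulate (λ x → does (image? h x))

∈image⁺ : (h : Fin k → Fin n) (i : Fin k) → h i ∈ image h
∈image⁺ h i = lookup⇒[]= (h i) (image h)
  (trans (lookup∘tabulate _ (h i)) (dec-true (image? h (h i)) (i , refl)))

∈image⁻ : (h : Fin k → Fin n) {x : Fin n} → x ∈ image h → Image h x
∈image⁻ h {x} x∈ with image? h x | trans (sym (lookup∘tabulate _ x)) ([]=⇒lookup x∈)
... | yes hit | _  = hit
... | no _    | ()

position : (p : Subset n) {x : Fin n} → x ∈ p → Fin ∣ p ∣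
position (inside  ∷ p) here       = zero
position (inside  ∷ p) (there x∈) = suc (position p x∈)
position (outside ∷ p) (there x∈) = position p x∈

position-injective : (p : Subset n) {x y : Fin n} (x∈ : x ∈ p) (y∈ : y ∈ p) →
  position p x∈ ≡ position p y∈ → x ≡ y
position-injective (inside  ∷ p) here       here       _  = refl
position-injective (inside  ∷ p) (there x∈) (there y∈) eq =
  cong suc (position-injective p x∈ y∈ (suc-injective eq))
position-injective (outside ∷ p) (there x∈) (there y∈) eq =
  cong suc (position-injective p x∈ y∈ eq)

injective-into⇒≤∣∣ : (p : Subset n) (h : Fin k → Fin n) → Injective _≡_ _≡_ h →
  (∀ i → h i ∈ p) → k ≤ ∣ p ∣
injective-into⇒≤∣∣ p h h-inj h∈ = injective⇒≤ {f = λ i → position p (h∈ i)}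
  (h-inj ∘ position-injective p (h∈ _) (h∈ _))

injective⇒≤∣image∣ : (h : Fin k → Fin n) → Injective _≡_ _≡_ h → k ≤ ∣ image h ∣
injective⇒≤∣image∣ h h-inj = injective-into⇒≤∣∣ (image h) h h-inj (∈image⁺ h)

injective-off-image⇒≤ : (f : Fin n → Fin k) (h : Fin l → Fin n) →
  (∀ {u v} → ¬ Image h u → ¬ Image h v → f u ≡ f v → u ≡ v) → n ≤ k + l
injective-off-image⇒≤ {n} {k} {l} f h f-inj =
  injective⇒≤ {f = λ v → join k l (tag v (image? h v))} λ {u} {v} eq →
    tag-injective (image? h u) (image? h v)
      (trans (sym (splitAt-join k l _)) (trans (cong (splitAt k) eq) (splitAt-join k l _)))
  where
  tag : (v : Fin n) → Dec (Image h v) → Fin k ⊎ Fin l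
  tag v (yes (j , _)) = inj₂ j
  tag v (no _)        = inj₁ (f v)

  tag-injective : ∀ {u v} (u? : Dec (Image h u)) (v? : Dec (Image h v)) →
    tag u u? ≡ tag v v? → u ≡ v
  tag-injective (yes (j , refl)) (yes (j , refl)) refl = refl
  tag-injective (no ¬hu)         (no ¬hv)         eq   = f-inj ¬hu ¬hv (inj₁-injective eq)
  tag-injective (yes _) (no _)  ()
  tag-injective (no _)  (yes _) ()

Classifies : (R : Rel (Fin n) ℓ) → (Fin n → Fin k) → Set ℓ
Classifies R f = Surjective _≡_ _≡_ f × (∀ u v → f u ≡ f v ⇔ R u v)

classify : {R : Rel (Fin n) ℓ} → IsDecEquivalence R →
  ∃₂ λ k (f : Fin n → Fin k) → Classifies R f
classify {n = 0}     _ = 0 , (λ ()) , (λ ()) , (λ ())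
classify {n = suc n} {R = R} R-equiv =
  extend (classify (On.isDecEquivalence suc R-equiv)) (any? (λ j → R._≟_ zero (suc j)))
  where
  module R = IsDecEquivalence R-equiv

  extend : ∃₂ (λ k (f : Fin n → Fin k) → Classifies (λ i j → R (suc i) (suc j)) f) →
    Dec (∃ λ j → R zero (suc j)) → ∃₂ λ k (f : Fin (suc n) → Fin k) → Classifies R f
  extend (k , f , f-surj , f-cls) (yes (j , r)) = k , f′ , f′-surj , f′-cls
    where
    f′ : Fin (suc n) → Fin k
    f′ zero    = f j
    f′ (suc i) = f i

    f′-surj : Surjective _≡_ _≡_ f′
    f′-surj y = let (x , fx≡y) = f-surj y in suc x , λ { refl → fx≡y refl }

    f′-cls : ∀ u v → f′ u ≡ f′ v ⇔ R u v
    f′-cls zero    zero    = mk⇔ (λ _ → R.refl) (λ _ → refl)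
    f′-cls zero    (suc v) = mk⇔ (R.trans r ∘ to (f-cls j v))
                                 (from (f-cls j v) ∘ R.trans (R.sym r))
    f′-cls (suc u) zero    = mk⇔ (R.sym ∘ R.trans r ∘ to (f-cls j u) ∘ sym)
                                 (sym ∘ from (f-cls j u) ∘ R.trans (R.sym r) ∘ R.sym)
    f′-cls (suc u) (suc v) = f-cls u v
  extend (k , f , f-surj , f-cls) (no ¬r) = suc k , f′ , f′-surj , f′-cls
    where
    f′ : Fin (suc n) → Fin (suc k)
    f′ zero    = zero
    f′ (suc i) = suc (f i)

    f′-surj : Surjective _≡_ _≡_ f′
    f′-surj zero    = zero , λ { refl → refl }
    f′-surj (suc y) = let (x , fx≡y) = f-surj y
                      in suc x , λ { refl → cong suc (fx≡y refl) }

    f′-cls : ∀ u v → f′ u ≡ f′ v ⇔ R u v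
    f′-cls zero    zero    = mk⇔ (λ _ → R.refl) (λ _ → refl)
    f′-cls zero    (suc v) = mk⇔ (λ ()) (λ r → ⊥-elim (¬r (v , r)))
    f′-cls (suc u) zero    = mk⇔ (λ ()) (λ r → ⊥-elim (¬r (u , R.sym r)))
    f′-cls (suc u) (suc v) = mk⇔ (to (f-cls u v) ∘ suc-injective)
                                 (cong suc ∘ from (f-cls u v))

SameEnds-sym : {a b c d : Fin n} → SameEnds (a , b) (c , d) → SameEnds (c , d) (a , b)
SameEnds-sym (inj₁ (refl , refl)) = inj₁ (refl , refl)
SameEnds-sym (inj₂ (refl , refl)) = inj₂ (refl , refl)

SameEnds-trans : {a b c d e f : Fin n} →
  SameEnds (a , b) (c , d) → SameEnds (c , d) (e , f) → SameEnds (a , b) (e , f)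
SameEnds-trans (inj₁ (refl , refl)) s                    = s
SameEnds-trans (inj₂ (refl , refl)) (inj₁ (refl , refl)) = inj₂ (refl , refl)
SameEnds-trans (inj₂ (refl , refl)) (inj₂ (refl , refl)) = inj₁ (refl , refl)

SameEnds-swapʳ : {a b c d : Fin n} → SameEnds (a , b) (c , d) → SameEnds (a , b) (d , c)
SameEnds-swapʳ (inj₁ (p , q)) = inj₂ (p , q)
SameEnds-swapʳ (inj₂ (p , q)) = inj₁ (p , q)

module _ (G : Graph) where

  Step-sym : ∀ {A u v} → Step G A u v → Step G A v u
  Step-sym (e , e∈A , e-ends) = e , e∈A , SameEnds-swapʳ e-ends

  Connected-isEquivalence : (A : Subset (Graph.m G)) → IsEquivalence (Connected G A)
  Connected-isEquivalence A = record
    { refl = ε ; sym = reverse Step-sym ; trans = _◅◅_ }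

cyclicPred : Fin (suc l) → Fin (suc l)
cyclicPred {l} zero = fromℕ l
cyclicPred (suc i)  = inject₁ i

cyclicPred²≢id : 2 ≤ l → (i : Fin (suc l)) → cyclicPred (cyclicPred i) ≢ i
cyclicPred²≢id (s≤s (s≤s _)) zero          ()
cyclicPred²≢id (s≤s (s≤s _)) (suc zero)    ()
cyclicPred²≢id (s≤s (s≤s _)) (suc (suc i)) eq = m≢1+n+m (toℕ i) (begin
  toℕ i                       ≡⟨ sym (toℕ-inject₁ i) ⟩
  toℕ (inject₁ i)             ≡⟨ sym (toℕ-inject₁ (inject₁ i)) ⟩
  toℕ (inject₁ (inject₁ i))   ≡⟨ cong toℕ eq ⟩
  2 + toℕ i                   ∎)
  where open ≡-Reasoning

module Cycle (G : Graph) {l : ℕ} (2≤l : 2 ≤ l)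
  (w : Fin (suc l) → Fin (Graph.n G)) (w-injective : Injective _≡_ _≡_ w)
  (path : ∀ i → Adjacent G (w (inject₁ i)) (w (suc i)))
  (closing : Adjacent G (w (fromℕ l)) (w zero)) where
  open Graph G using (m; ends)

  edgeInto : ∀ i → Adjacent G (w (cyclicPred i)) (w i)
  edgeInto zero    = closing
  edgeInto (suc i) = path i

  edge : Fin (suc l) → Fin m
  edge = proj₁ ∘ edgeInto

  edge-ends : ∀ i → SameEnds (ends (edge i)) (w (cyclicPred i) , w i)
  edge-ends = proj₂ ∘ proj₂ ∘ edgeInto

  edge-injective : Injective _≡_ _≡_ edge
  edge-injective {i} {j} eq
    with SameEnds-trans (SameEnds-sym (edge-ends i))
           (subst (λ e → SameEnds (ends e) _) (sym eq) (edge-ends j))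
  ... | inj₁ (_ , wi≡wj) = w-injective wi≡wj
  ... | inj₂ (wpi≡wj , wi≡wpj) = ⊥-elim (cyclicPred²≢id 2≤l i
          (trans (cong cyclicPred (w-injective wpi≡wj)) (sym (w-injective wi≡wpj))))

  cycleEdges : Subset m
  cycleEdges = image edge

  OnCycle : Pred (Fin (Graph.n G)) 0ℓ
  OnCycle = Image w

  step : ∀ i → Step G cycleEdges (w (cyclicPred i)) (w i)
  step i = edge i , ∈image⁺ edge i , edge-ends i

  Step⇒OnCycle : ∀ {u v} → Step G cycleEdges u v → OnCycle u × OnCycle v
  Step⇒OnCycle (e , e∈ , e-ends) with ∈image⁻ edge e∈
  ... | i , refl = ends-onCycle (SameEnds-trans (SameEnds-sym (edge-ends i)) e-ends)
    where
    ends-onCycle : ∀ {a b u v} → SameEnds (w a , w b) (u , v) → OnCycle u × OnCycle v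
    ends-onCycle {a} {b} (inj₁ (refl , refl)) = (a , refl) , (b , refl)
    ends-onCycle {a} {b} (inj₂ (refl , refl)) = (b , refl) , (a , refl)

  Connected⇒OnCycle : ∀ {u v} → Connected G cycleEdges u v →
    u ≡ v ⊎ (OnCycle u × OnCycle v)
  Connected⇒OnCycle ε            = inj₁ refl
  Connected⇒OnCycle (s ◅ u′~v) with Step⇒OnCycle s | Connected⇒OnCycle u′~v
  ... | onU , onU′ | inj₁ refl      = inj₂ (onU , onU′)
  ... | onU , _    | inj₂ (_ , onV) = inj₂ (onU , onV)

  root-connected : ∀ i → Connected G cycleEdges (w zero) (w i)
  root-connected = <-weakInduction (Connected G cycleEdges (w zero) ∘ w) ε
    (λ i root~i → root~i ◅◅ step (suc i) ◅ ε)

  OnCycle⇒Connected : ∀ {u v} → OnCycle u → OnCycle v → Connected G cycleEdges u v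
  OnCycle⇒Connected (i , refl) (j , refl) =
    reverse (Step-sym G) (root-connected i) ◅◅ root-connected j

  connected? : ∀ u v → Dec (Connected G cycleEdges u v)
  connected? u v = Dec.map
    (mk⇔ [ (λ { refl → ε }) , uncurry OnCycle⇒Connected ] Connected⇒OnCycle)
    (u ≟ v ⊎-dec (image? w u ×-dec image? w v))

  cycleEdges-numComponents : ∃ (NumComponents G cycleEdges)
  cycleEdges-numComponents = classify Connected-isDecEquivalence
    where
    Connected-isDecEquivalence : IsDecEquivalence (Connected G cycleEdges)
    Connected-isDecEquivalence = record
      { isEquivalence = Connected-isEquivalence G cycleEdges ; _≟_ = connected? }

  off-suc-image⇒root : ∀ {u} → OnCycle u → ¬ Image (w ∘ suc) u → u ≡ w zero
  off-suc-image⇒root (zero  , wi≡u) _    = sym wi≡u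
  off-suc-image⇒root (suc i , wi≡u) ¬hit = ⊥-elim (¬hit (i , wi≡u))

  Connected-off-suc-image⇒≡ : ∀ {u v} → ¬ Image (w ∘ suc) u → ¬ Image (w ∘ suc) v →
    Connected G cycleEdges u v → u ≡ v
  Connected-off-suc-image⇒≡ ¬hu ¬hv u~v with Connected⇒OnCycle u~v
  ... | inj₁ u≡v         = u≡v
  ... | inj₂ (onU , onV) = trans (off-suc-image⇒root onU ¬hu) (sym (off-suc-image⇒root onV ¬hv))

  -- Labelling w (suc i) by i and every other vertex by its component injects
  -- the vertices into k + l labels.
  rank-cycleEdges : ∀ {k} → NumComponents G cycleEdges k → rank G k ≤ l
  rank-cycleEdges {k} (f , _ , f-cls) = m≤n+o⇒m∸n≤o (Graph.n G) k
    (injective-off-image⇒≤ f (w ∘ suc) λ ¬hu ¬hv →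
      Connected-off-suc-image⇒≡ ¬hu ¬hv ∘ to (f-cls _ _))

proposition3p8 : (G : Graph) → UniformlyDense G → HasCycle G →
    ∀ (kE : ℕ) → NumComponents G ⊤ kE →
    ∀ (g : ℕ) → IsGirth G g →
    Graph.m G ≤ g * (Graph.m G ∸ rank G kE)
proposition3p8 G _ _ _ _ 0 (() , _)
proposition3p8 G uniformlyDense _ kE componentsE (suc l) ((2≤l , w , w-inj , path , closing) , _) =
  cross-multiplied-girth-bound m l (rank G kE) (begin
    suc l * rank G kE          ≤⟨ *-monoˡ-≤ (rank G kE) (injective⇒≤∣image∣ edge edge-injective) ⟩
    ∣ cycleEdges ∣ * rank G kE ≤⟨ uniformlyDense cycleEdges kA kE componentsA componentsE
                                   (edge zero , ∈image⁺ edge zero) ⟩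
    m * rank G kA              ≤⟨ *-monoʳ-≤ m (rank-cycleEdges componentsA) ⟩
    m * l                      ∎)
  where
  open Graph G using (m)
  open Cycle G 2≤l w w-inj path closing
  open ≤-Reasoning
  kA : ℕ
  kA = proj₁ cycleEdges-numComponents
  componentsA : NumComponents G cycleEdges kA
  componentsA = proj₂ cycleEdges-numComponents
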